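{- Let $M$ and $N$ be finite MTL-algebras and $f:M\to N$ an MTL-homomorphism. There exists a unique p-morphism $f^\ast:\mathcal J(\mathcal I(N))\to\mathcal J(\mathcal I(M))$ such that $\uparrow f^\ast(e)=f^{ -1}(\uparrow e)$ for every $e\in\mathcal J(\mathcal I(N))$ (i.e. $f^\ast=\varphi_M^{ -1}\circ\mathrm{Spec}(f)\circ\varphi_N$, where $\varphi_M(e)=\uparrow e$ and $\mathrm{Spec}(f)=f^{ -1}$).
   Context: An MTL-algebra is a bounded, integral, commutative, prelinear residuated lattice. $\mathcal I(M)$ is the poset of idempotents of $M$, $\mathcal J(\mathcal I(M))$ its join-irreducible elements; for finite $M$, $e\mapsto\uparrow e$ is a bijection $\varphi_M$ from $\mathcal J(\mathcal I(M))$ onto the set $\mathrm{Spec}(M)$ of prime filters (filters $P$ with $0\notin P$ and $x\vee y\in P\Rightarrow x\in P$ or $y\in P$). A p-morphism is a monotone map $g:X\to Y$ such that for $x\in X$, $y\in Y$ with $y\le g(x)$ there exists $z\le x$ with $g(z)=y$. -}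

module Defs where

open import Data.Nat using (ℕ)
open import Data.Fin using (Fin)
open import Data.Product using (Σ; _×_; _,_; proj₁; ∃-syntax)
open import Data.Sum using (_⊎_)
open import Relation.Binary.PropositionalEquality using (_≡_)
open import Relation.Nullary using (¬_)
open import Function.Bundles using (_↔_; _⇔_)

record MTL : Set₁ where
  infixr 6 _∨_
  infixr 7 _∧_
  infixr 8 _⊙_
  infixr 5 _⇒_
  infix 4 _≤_
  field
    Carrier : Set
    _∧_ _∨_ _⊙_ _⇒_ : Carrier → Carrier → Carrier
    𝟘 𝟙 : Carrier
  _≤_ : Carrier → Carrier → Set
  x ≤ y = x ∧ y ≡ x
  field
    ∧-comm  : ∀ x y → x ∧ y ≡ y ∧ x
    ∨-comm  : ∀ x y → x ∨ y ≡ y ∨ x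
    ∧-assoc : ∀ x y z → (x ∧ y) ∧ z ≡ x ∧ (y ∧ z)
    ∨-assoc : ∀ x y z → (x ∨ y) ∨ z ≡ x ∨ (y ∨ z)
    ∧-absorbs-∨ : ∀ x y → x ∧ (x ∨ y) ≡ x
    ∨-absorbs-∧ : ∀ x y → x ∨ (x ∧ y) ≡ x
    𝟘-least : ∀ x → 𝟘 ≤ x
    𝟙-greatest : ∀ x → x ≤ 𝟙
    ⊙-comm  : ∀ x y → x ⊙ y ≡ y ⊙ x
    ⊙-assoc : ∀ x y z → (x ⊙ y) ⊙ z ≡ x ⊙ (y ⊙ z)
    ⊙-identityʳ : ∀ x → x ⊙ 𝟙 ≡ x
    residuation : ∀ x y z → (x ⊙ y ≤ z) ⇔ (x ≤ y ⇒ z)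
    prelinear : ∀ x y → (x ⇒ y) ∨ (y ⇒ x) ≡ 𝟙

record FinMTL : Set₁ where
  field
    alg  : MTL
    size : ℕ
    enum : Fin size ↔ MTL.Carrier alg
  open MTL alg public

Car : FinMTL → Set
Car M = FinMTL.Carrier M

record Hom (M N : FinMTL) : Set where
  private
    module M = FinMTL M
    module N = FinMTL N
  field
    fun   : M.Carrier → N.Carrier
    pres-∧ : ∀ x y → fun (x M.∧ y) ≡ fun x N.∧ fun y
    pres-∨ : ∀ x y → fun (x M.∨ y) ≡ fun x N.∨ fun y
    pres-⊙ : ∀ x y → fun (x M.⊙ y) ≡ fun x N.⊙ fun y
    pres-⇒ : ∀ x y → fun (x M.⇒ y) ≡ fun x N.⇒ fun y
    pres-𝟘 : fun M.𝟘 ≡ N.𝟘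
    pres-𝟙 : fun M.𝟙 ≡ N.𝟙
open Hom public

module _ (M : FinMTL) where
  open FinMTL M

  Idem : Carrier → Set
  Idem e = e ⊙ e ≡ e

  -- join-irreducible elements of the (finite) lattice 𝓘(M): not the bottom
  -- 𝟘 of 𝓘(M), and not a join of two idempotents unless equal to one of them.
  -- (𝓘(M) is closed under ∨, so joins in 𝓘(M) are joins in M.)
  JoinIrr : Carrier → Set
  JoinIrr e = Idem e × ¬ (e ≡ 𝟘)
            × (∀ a b → Idem a → Idem b → e ≡ a ∨ b → (e ≡ a) ⊎ (e ≡ b))

  𝓙𝓘 : Set
  𝓙𝓘 = Σ Carrier JoinIrr

  elt : 𝓙𝓘 → Carrier
  elt = proj₁

  _≤𝓙_ : 𝓙𝓘 → 𝓙𝓘 → Set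
  e ≤𝓙 e' = elt e ≤ elt e'

IsPMorphism : (X Y : FinMTL) → (𝓙𝓘 X → 𝓙𝓘 Y) → Set
IsPMorphism X Y g =
    (∀ x x' → _≤𝓙_ X x x' → _≤𝓙_ Y (g x) (g x'))
  × (∀ x y → _≤𝓙_ Y y (g x) → ∃[ z ] (_≤𝓙_ X z x × elt Y (g z) ≡ elt Y y))

↑ : (M : FinMTL) → Car M → Car M → Set
↑ M a x = FinMTL._≤_ M a x

DualCond : (M N : FinMTL) → Hom M N → (𝓙𝓘 N → 𝓙𝓘 M) → Set
DualCond M N f g =
  ∀ (e : 𝓙𝓘 N) (x : Car M) → ↑ M (elt M (g e)) x ⇔ ↑ N (elt N e) (fun f x)

module Submission where

-- For an idempotent a of N, the set { x ∈ M ∣ a ≤ f x } is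
-- closed under ⊙ (as a = a ⊙ a) and contains 𝟙, so the finite algebra M has
-- a least element h a of it.  This gives a Galois connection
--     h a ≤ x  ⇔  a ≤ f x          (a idempotent),
-- i.e. ↑ (h a) = f⁻¹ (↑ a), which is exactly the defining property of f*.
-- Hence f* e := h e, and uniqueness holds because an element is determined
-- by its principal up-set.  Join-irreducibility of e transfers to h e since
-- join-irreducible idempotents are join-prime among idempotents.  For the
-- back condition of a p-morphism, given d ≤ h e we put u = e ⊙ f d, show
-- d ≤ h u, and take a minimal idempotent z ≤ u with d ≤ h z; minimality and
-- join-primeness of d make z join-irreducible, and z ≤ u ≤ f d gives h z = d.

open import Defs
open import Data.Nat using (ℕ; zero; suc)
open import Data.Fin using (Fin)
import Data.Fin as Fin
import Data.Fin.Properties as FinP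
open import Data.Product using (Σ; _×_; _,_; proj₁; proj₂; ∃-syntax)
open import Data.Sum using (_⊎_)
import Data.Sum as Sum
open import Data.Empty using (⊥-elim)
open import Function.Base using (_∘_)
open import Function.Bundles using (_⇔_; Equivalence; Inverse; mk⇔)
open import Function.Properties.Inverse using (↔-sym; ↔⇒↣)
import Function.Properties.Equivalence as ⇔
open import Relation.Nullary using (¬_; Dec; yes; no)
open import Relation.Nullary.Decidable using (_×-dec_)
open import Relation.Binary.Definitions using (DecidableEquality)
open import Relation.Binary.PropositionalEquality
open import Algebra.Lattice.Bundles using (Lattice)
import Algebra.Lattice.Properties.Lattice as LatticeProperties
import Relation.Binary.Lattice as OrderTheoretic
import Relation.Binary.Lattice.Properties.JoinSemilattice as JoinSemilatticeProperties

module MTLProperties (A : MTL) where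
  open MTL A

  lattice : Lattice _ _
  lattice = record
    { Carrier   = Carrier
    ; _≈_       = _≡_
    ; _∨_       = _∨_
    ; _∧_       = _∧_
    ; isLattice = record
      { isEquivalence = isEquivalence
      ; ∨-comm        = ∨-comm
      ; ∨-assoc       = ∨-assoc
      ; ∨-cong        = cong₂ _∨_
      ; ∧-comm        = ∧-comm
      ; ∧-assoc       = ∧-assoc
      ; ∧-cong        = cong₂ _∧_
      ; absorptive    = ∨-absorbs-∧ , ∧-absorbs-∨
      }
    }

  -- The library orders it by  x ≡ x ∧ y , the symmetric form of  _≤_ .
  private
    module L = OrderTheoretic.Lattice
                 (LatticeProperties.∨-∧-orderTheoreticLattice lattice)

  ≤-refl : ∀ {x} → x ≤ x
  ≤-refl = sym L.refl

  ≤-trans : ∀ {x y z} → x ≤ y → y ≤ z → x ≤ z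
  ≤-trans p q = sym (L.trans (sym p) (sym q))

  ≤-antisym : ∀ {x y} → x ≤ y → y ≤ x → x ≡ y
  ≤-antisym p q = L.antisym (sym p) (sym q)

  x≤x∨y : ∀ x y → x ≤ x ∨ y
  x≤x∨y x y = sym (L.x≤x∨y x y)

  y≤x∨y : ∀ x y → y ≤ x ∨ y
  y≤x∨y x y = sym (L.y≤x∨y x y)

  ∨-least : ∀ {x y z} → x ≤ z → y ≤ z → x ∨ y ≤ z
  ∨-least p q = sym (L.∨-least (sym p) (sym q))

  ∨-mono : ∀ {a b c d} → a ≤ c → b ≤ d → a ∨ b ≤ c ∨ d
  ∨-mono p q =
    sym (JoinSemilatticeProperties.∨-monotonic L.joinSemilattice (sym p) (sym q))

  ≤𝟘⇒≡𝟘 : ∀ {x} → x ≤ 𝟘 → x ≡ 𝟘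
  ≤𝟘⇒≡𝟘 p = ≤-antisym p (𝟘-least _)

  ↑-injective : ∀ {a b} → (∀ x → a ≤ x ⇔ b ≤ x) → a ≡ b
  ↑-injective {a} {b} same =
    ≤-antisym (Equivalence.from (same b) ≤-refl) (Equivalence.to (same a) ≤-refl)

  residual : ∀ {x y z} → x ⊙ y ≤ z → x ≤ y ⇒ z
  residual = Equivalence.to (residuation _ _ _)

  unresidual : ∀ {x y z} → x ≤ y ⇒ z → x ⊙ y ≤ z
  unresidual = Equivalence.from (residuation _ _ _)

  ⊙-monoˡ : ∀ {x y} z → x ≤ y → x ⊙ z ≤ y ⊙ z
  ⊙-monoˡ z x≤y = unresidual (≤-trans x≤y (residual ≤-refl))

  ⊙-monoʳ : ∀ {x y} z → x ≤ y → z ⊙ x ≤ z ⊙ y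
  ⊙-monoʳ z x≤y = subst₂ _≤_ (⊙-comm _ z) (⊙-comm _ z) (⊙-monoˡ z x≤y)

  ⊙-mono : ∀ {a b c d} → a ≤ c → b ≤ d → a ⊙ b ≤ c ⊙ d
  ⊙-mono a≤c b≤d = ≤-trans (⊙-monoˡ _ a≤c) (⊙-monoʳ _ b≤d)

  x⊙y≤x : ∀ x y → x ⊙ y ≤ x
  x⊙y≤x x y = subst (x ⊙ y ≤_) (⊙-identityʳ x) (⊙-monoʳ x (𝟙-greatest y))

  x⊙y≤y : ∀ x y → x ⊙ y ≤ y
  x⊙y≤y x y = subst (_≤ y) (⊙-comm y x) (x⊙y≤x y x)

  -- ⊙ distributes over ∨ (the nontrivial half), as  x ⊙ _  is a left adjoint.
  ⊙-distribˡ-∨ : ∀ x a b → x ⊙ (a ∨ b) ≤ (x ⊙ a) ∨ (x ⊙ b)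
  ⊙-distribˡ-∨ x a b = subst (_≤ rhs) (⊙-comm (a ∨ b) x)
    (unresidual (∨-least (via a (x≤x∨y _ _)) (via b (y≤x∨y _ _))))
    where
      rhs = (x ⊙ a) ∨ (x ⊙ b)
      via : ∀ c → x ⊙ c ≤ rhs → c ≤ x ⇒ rhs
      via c p = residual (subst (_≤ rhs) (⊙-comm x c) p)

module FinMTLProperties (M : FinMTL) where
  open FinMTL M
  open MTLProperties alg public
  open ≡-Reasoning

  ⊙-idem : ∀ {a b} → Idem M a → Idem M b → Idem M (a ⊙ b)
  ⊙-idem {a} {b} ia ib = begin
    (a ⊙ b) ⊙ (a ⊙ b) ≡⟨ ⊙-assoc a b (a ⊙ b) ⟩
    a ⊙ (b ⊙ (a ⊙ b)) ≡⟨ cong (a ⊙_) (sym (⊙-assoc b a b)) ⟩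
    a ⊙ ((b ⊙ a) ⊙ b) ≡⟨ cong (λ t → a ⊙ (t ⊙ b)) (⊙-comm b a) ⟩
    a ⊙ ((a ⊙ b) ⊙ b) ≡⟨ cong (a ⊙_) (⊙-assoc a b b) ⟩
    a ⊙ (a ⊙ (b ⊙ b)) ≡⟨ cong (λ t → a ⊙ (a ⊙ t)) ib ⟩
    a ⊙ (a ⊙ b)       ≡⟨ sym (⊙-assoc a a b) ⟩
    (a ⊙ a) ⊙ b       ≡⟨ cong (_⊙ b) ia ⟩
    a ⊙ b             ∎

  idem-≤-⊙ : ∀ {a x y} → Idem M a → a ≤ x → a ≤ y → a ≤ x ⊙ y
  idem-≤-⊙ ia a≤x a≤y = subst (_≤ _) ia (⊙-mono a≤x a≤y)

  -- A join-irreducible idempotent is join-prime with respect to idempotents: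
  -- if e ≤ a ∨ b then e = (e ⊙ a) ∨ (e ⊙ b), a join of idempotents.
  joinIrr⇒prime : ∀ {e a b} → JoinIrr M e → Idem M a → Idem M b →
                  e ≤ a ∨ b → (e ≤ a) ⊎ (e ≤ b)
  joinIrr⇒prime {e} {a} {b} (ie , _ , irreducible) ia ib e≤a∨b =
    Sum.map below below (irreducible (e ⊙ a) (e ⊙ b) (⊙-idem ie ia) (⊙-idem ie ib) e≡join)
    where
      e≡join : e ≡ (e ⊙ a) ∨ (e ⊙ b)
      e≡join = ≤-antisym
        (subst (_≤ (e ⊙ a) ∨ (e ⊙ b)) ie (≤-trans (⊙-monoʳ e e≤a∨b) (⊙-distribˡ-∨ e a b)))
        (∨-least (x⊙y≤x e a) (x⊙y≤x e b))
      below : ∀ {c} → e ≡ e ⊙ c → e ≤ c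
      below {c} e≡e⊙c = subst (_≤ c) (sym e≡e⊙c) (x⊙y≤y e c)

  _≟_ : DecidableEquality Carrier
  _≟_ = FinP.inj⇒≟ (↔⇒↣ (↔-sym enum))

  _≤?_ : ∀ x y → Dec (x ≤ y)
  x ≤? y = (x ∧ y) ≟ x

  -- Minimal elements of a decidable subset C, found by one pass over an
  -- enumeration: the current candidate is replaced by any member of C below it.
  -- A skipped member is not below the candidate of its time, hence not below
  -- any later (smaller) candidate; an accepted one lies above the result.
  module MinimalSearch {p} {C : Carrier → Set p} (C? : ∀ x → Dec (C x)) where
    step : Carrier → Carrier → Carrier
    step x c with C? x ×-dec (x ≤? c)
    ... | yes _ = x
    ... | no  _ = c

    step-sat : ∀ x {c} → C c → C (step x c)
    step-sat x {c} Cc with C? x ×-dec (x ≤? c)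
    ... | yes (Cx , _) = Cx
    ... | no  _        = Cc

    step-≤ : ∀ x c → step x c ≤ c
    step-≤ x c with C? x ×-dec (x ≤? c)
    ... | yes (_ , x≤c) = x≤c
    ... | no  _         = ≤-refl

    step-accepts : ∀ {x c} → C x → x ≤ c → step x c ≡ x
    step-accepts {x} {c} Cx x≤c with C? x ×-dec (x ≤? c)
    ... | yes _ = refl
    ... | no ¬p = ⊥-elim (¬p (Cx , x≤c))

    scan : (n : ℕ) → (Fin n → Carrier) → Carrier → Carrier
    scan zero    φ c = c
    scan (suc n) φ c = scan n (φ ∘ Fin.suc) (step (φ Fin.zero) c)

    scan-sat : ∀ n φ {c} → C c → C (scan n φ c)
    scan-sat zero    φ Cc = Cc
    scan-sat (suc n) φ Cc = scan-sat n (φ ∘ Fin.suc) (step-sat (φ Fin.zero) Cc)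

    scan-≤ : ∀ n φ c → scan n φ c ≤ c
    scan-≤ zero    φ c = ≤-refl
    scan-≤ (suc n) φ c =
      ≤-trans (scan-≤ n (φ ∘ Fin.suc) (step (φ Fin.zero) c)) (step-≤ (φ Fin.zero) c)

    scan-minimal : ∀ n φ c (i : Fin n) → C (φ i) → φ i ≤ scan n φ c → φ i ≡ scan n φ c
    scan-minimal (suc n) φ c Fin.zero Cx x≤r =
      ≤-antisym x≤r (subst (r ≤_) (step-accepts Cx x≤c) r≤c′)
      where
        x = φ Fin.zero
        r = scan n (φ ∘ Fin.suc) (step x c)
        r≤c′ : r ≤ step x c
        r≤c′ = scan-≤ n (φ ∘ Fin.suc) (step x c)
        x≤c = ≤-trans x≤r (≤-trans r≤c′ (step-≤ x c))
    scan-minimal (suc n) φ c (Fin.suc i) = scan-minimal n (φ ∘ Fin.suc) (step (φ Fin.zero) c) i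

    -- A minimal element of C below c (for c ∈ C), scanning all of M.  It is
    -- opaque so that type checking never unfolds the search; only the two
    -- properties below are used.
    opaque
      minimal : Carrier → Carrier
      minimal = scan size (Inverse.to enum)

    opaque
      unfolding minimal

      minimal-sat : ∀ {c} → C c → C (minimal c)
      minimal-sat = scan-sat size (Inverse.to enum)

      minimal-minimal : ∀ {c a} → C a → a ≤ minimal c → a ≡ minimal c
      minimal-minimal {c} {a} Ca a≤m =
        subst (_≡ minimal c) (Inverse.strictlyInverseˡ enum a)
          (scan-minimal size (Inverse.to enum) c (Inverse.from enum a)
                        (enumerated {P = C} Ca) (enumerated {P = _≤ minimal c} a≤m))
        where
          enumerated : ∀ {q} {P : Carrier → Set q} → P a →
                       P (Inverse.to enum (Inverse.from enum a))
          enumerated {P = P} = subst P (sym (Inverse.strictlyInverseˡ enum a))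

    minimal-least : (∀ {x y} → C x → C y → C (x ⊙ y)) →
                    ∀ {c x} → C c → C x → minimal c ≤ x
    minimal-least closed {c} {x} Cc Cx =
      subst (_≤ x) m⊙x≡m (x⊙y≤y m x)
      where
        m = minimal c
        m⊙x≡m : m ⊙ x ≡ m
        m⊙x≡m = minimal-minimal (closed (minimal-sat Cc) Cx) (x⊙y≤x m x)

module Dual (M N : FinMTL) (f : Hom M N) where
  private
    module M = FinMTL M
    module N = FinMTL N
    module PM = FinMTLProperties M
    module PN = FinMTLProperties N

  f-mono : ∀ {x y} → x M.≤ y → fun f x N.≤ fun f y
  f-mono {x} {y} x≤y = trans (sym (pres-∧ f x y)) (cong (fun f) x≤y)

  f-idem : ∀ {x} → Idem M x → Idem N (fun f x)
  f-idem {x} ix = trans (sym (pres-⊙ f x x)) (cong (fun f) ix)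

  module Preimage (a : N.Carrier) = PM.MinimalSearch (λ x → a PN.≤? fun f x)

  h : N.Carrier → M.Carrier
  h a = Preimage.minimal a M.𝟙

  ≤f𝟙 : ∀ a → a N.≤ fun f M.𝟙
  ≤f𝟙 a = subst (a N.≤_) (sym (pres-𝟙 f)) (N.𝟙-greatest a)

  h-unit : ∀ a → a N.≤ fun f (h a)
  h-unit a = Preimage.minimal-sat a (≤f𝟙 a)

  -- For idempotent a the preimage is closed under ⊙, so h a is its least element.
  h-least : ∀ {a x} → Idem N a → a N.≤ fun f x → h a M.≤ x
  h-least {a} ia a≤fx = Preimage.minimal-least a closed (≤f𝟙 a) a≤fx
    where
      closed : ∀ {x y} → a N.≤ fun f x → a N.≤ fun f y → a N.≤ fun f (x M.⊙ y)
      closed p q = subst (a N.≤_) (sym (pres-⊙ f _ _)) (PN.idem-≤-⊙ ia p q)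

  galois : ∀ {a} → Idem N a → ∀ x → h a M.≤ x ⇔ a N.≤ fun f x
  galois ia x = mk⇔ (λ ha≤x → PN.≤-trans (h-unit _) (f-mono ha≤x)) (h-least ia)

  h-mono : ∀ {a b} → Idem N a → a N.≤ b → h a M.≤ h b
  h-mono ia a≤b = h-least ia (PN.≤-trans a≤b (h-unit _))

  h-idem : ∀ {a} → Idem N a → Idem M (h a)
  h-idem {a} ia = PM.≤-antisym (PM.x⊙y≤x _ _)
    (h-least ia (subst (a N.≤_) (sym (pres-⊙ f _ _))
                       (PN.idem-≤-⊙ ia (h-unit a) (h-unit a))))

  -- 𝟘 lies in f⁻¹(↑ 𝟘) below h 𝟘, so minimality gives h 𝟘 = 𝟘.
  h-𝟘 : h N.𝟘 ≡ M.𝟘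
  h-𝟘 = sym (Preimage.minimal-minimal N.𝟘 (N.𝟘-least _) (M.𝟘-least _))

  h-∨ : ∀ {a b} → Idem N (a N.∨ b) → h (a N.∨ b) M.≤ h a M.∨ h b
  h-∨ {a} {b} i = h-least i (subst (a N.∨ b N.≤_) (sym (pres-∨ f _ _))
                                  (PN.∨-mono (h-unit a) (h-unit b)))

  h-projection : ∀ {e} x → Idem N e → h e M.⊙ x M.≤ h (e N.⊙ fun f x)
  h-projection {e} x ie = PM.unresidual (h-least ie e≤f[x⇒hu])
    where
      u = e N.⊙ fun f x
      e≤f[x⇒hu] : e N.≤ fun f (x M.⇒ h u)
      e≤f[x⇒hu] = subst (e N.≤_) (sym (pres-⇒ f x (h u))) (PN.residual (h-unit u))

  h-joinIrr : ∀ {e} → JoinIrr N e → JoinIrr M (h e)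
  h-joinIrr {e} je@(ie , e≢𝟘 , _) = h-idem ie , he≢𝟘 , irreducible
    where
      he≢𝟘 : ¬ (h e ≡ M.𝟘)
      he≢𝟘 he≡𝟘 = e≢𝟘 (PN.≤𝟘⇒≡𝟘 (subst (e N.≤_) (trans (cong (fun f) he≡𝟘) (pres-𝟘 f))
                                                (h-unit e)))
      irreducible : ∀ a b → Idem M a → Idem M b → h e ≡ a M.∨ b → (h e ≡ a) ⊎ (h e ≡ b)
      irreducible a b ia ib he≡a∨b =
        Sum.map (λ e≤fa → PM.≤-antisym (h-least ie e≤fa) (part (PM.x≤x∨y a b)))
                (λ e≤fb → PM.≤-antisym (h-least ie e≤fb) (part (PM.y≤x∨y a b)))
                (PN.joinIrr⇒prime je (f-idem ia) (f-idem ib) e≤fa∨fb)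
        where
          e≤fa∨fb : e N.≤ fun f a N.∨ fun f b
          e≤fa∨fb = subst (e N.≤_) (trans (cong (fun f) he≡a∨b) (pres-∨ f a b)) (h-unit e)
          part : ∀ {c} → c M.≤ a M.∨ b → c M.≤ h e
          part {c} = subst (c M.≤_) (sym he≡a∨b)

  -- Lifting along h: if a join-irreducible d lies below h u (u idempotent),
  -- then d ≤ h z for some join-irreducible z ≤ u, namely a minimal idempotent
  -- z ≤ u with d ≤ h z.  A splitting z = a ∨ b gives d ≤ h a ∨ h b, so by
  -- join-primeness of d one of a, b satisfies the same condition, and
  -- minimality forces it to be z.
  lift : ∀ {d u} → JoinIrr M d → Idem N u → d M.≤ h u →
         ∃[ z ] (JoinIrr N z × z N.≤ u × d M.≤ h z)
  lift {d} {u} jd@(_ , d≢𝟘 , _) iu d≤hu =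
    z , (iz , z≢𝟘 , irreducible) , z≤u , d≤hz
    where
      C : N.Carrier → Set
      C z = Idem N z × z N.≤ u × d M.≤ h z
      C? : ∀ z → Dec (C z)
      C? z = ((z N.⊙ z) PN.≟ z) ×-dec (z PN.≤? u) ×-dec (d PM.≤? h z)
      open PN.MinimalSearch C? using (minimal; minimal-sat; minimal-minimal)
      z = minimal u
      Cz : C z
      Cz = minimal-sat (iu , PN.≤-refl , d≤hu)
      iz = proj₁ Cz
      z≤u = proj₁ (proj₂ Cz)
      d≤hz = proj₂ (proj₂ Cz)
      z≢𝟘 : ¬ (z ≡ N.𝟘)
      z≢𝟘 z≡𝟘 = d≢𝟘 (PM.≤𝟘⇒≡𝟘 (subst (d M.≤_) (trans (cong h z≡𝟘) h-𝟘) d≤hz))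
      part≡z : ∀ {a} → Idem N a → a N.≤ z → d M.≤ h a → z ≡ a
      part≡z ia a≤z d≤ha = sym (minimal-minimal (ia , PN.≤-trans a≤z z≤u , d≤ha) a≤z)
      irreducible : ∀ a b → Idem N a → Idem N b → z ≡ a N.∨ b → (z ≡ a) ⊎ (z ≡ b)
      irreducible a b ia ib z≡a∨b =
        Sum.map (part≡z ia (part (PN.x≤x∨y a b))) (part≡z ib (part (PN.y≤x∨y a b)))
                (PM.joinIrr⇒prime jd (h-idem ia) (h-idem ib) d≤ha∨hb)
        where
          d≤ha∨hb : d M.≤ h a M.∨ h b
          d≤ha∨hb = PM.≤-trans d≤hz (subst (λ t → h t M.≤ h a M.∨ h b) (sym z≡a∨b)
                                           (h-∨ (subst (Idem N) z≡a∨b iz)))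
          part : ∀ {c} → c N.≤ a N.∨ b → c N.≤ z
          part {c} = subst (c N.≤_) (sym z≡a∨b)

  f* : 𝓙𝓘 N → 𝓙𝓘 M
  f* (e , je) = h e , h-joinIrr je

  f*-dual : DualCond M N f f*
  f*-dual (e , ie , _) = galois ie

  -- Back condition: for d ≤ f* e, lift d along h below u = e ⊙ f d; the
  -- lift z satisfies z ≤ e and, as z ≤ f d, also h z = d.
  f*-back : ∀ e d → _≤𝓙_ M d (f* e) → ∃[ z ] (_≤𝓙_ N z e × elt M (f* z) ≡ elt M d)
  f*-back (e , je@(ie , _)) (d , jd@(id , _)) d≤he = conclude (lift jd iu d≤hu)
    where
      u = e N.⊙ fun f d
      iu : Idem N u
      iu = PN.⊙-idem ie (f-idem id)
      -- d = d ⊙ d ≤ h e ⊙ d ≤ h u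
      d≤hu : d M.≤ h u
      d≤hu = subst (M._≤ h u) id (PM.≤-trans (PM.⊙-monoˡ d d≤he) (h-projection d ie))
      conclude : ∃[ z ] (JoinIrr N z × z N.≤ u × d M.≤ h z) →
                 ∃[ z ] (_≤𝓙_ N z (e , je) × h (elt N z) ≡ d)
      conclude (z , jz , z≤u , d≤hz) =
        (z , jz) , PN.≤-trans z≤u (PN.x⊙y≤x e _) ,
        PM.≤-antisym (h-least (proj₁ jz) (PN.≤-trans z≤u (PN.x⊙y≤y e _))) d≤hz

  f*-pmorphism : IsPMorphism N M f*
  f*-pmorphism = (λ { (_ , ie , _) _ e≤e′ → h-mono ie e≤e′ }) , f*-back

  -- Any map with the defining property agrees with f*: elements with the
  -- same principal up-set are equal.
  f*-unique : ∀ g → DualCond M N f g → ∀ e → elt M (g e) ≡ elt M (f* e)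
  f*-unique g dual e = PM.↑-injective (λ x → ⇔.trans (dual e x) (⇔.sym (f*-dual e x)))

lemma3p12 : (M N : FinMTL) (f : Hom M N) →
    Σ (𝓙𝓘 N → 𝓙𝓘 M) (λ g →
        IsPMorphism N M g × DualCond M N f g
      × (∀ (g' : 𝓙𝓘 N → 𝓙𝓘 M) → IsPMorphism N M g' → DualCond M N f g' →
           ∀ e → elt M (g' e) ≡ elt M (g e)))
lemma3p12 M N f = f* , f*-pmorphism , f*-dual , λ g _ → f*-unique g
  where open Dual M N f
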